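{- Let $k\ge 1$ and let $(\phi,\mathbf{B})$ be a QCSP instance. If there exists a $k$-constraint system for $(\phi,\mathbf{B})$, then $(\phi,\mathbf{B})$ is $k$-judge-consistent.
   Context: Multi-sorted relational first-order logic: structures $\mathbf{B}$ have sort universes $B_s$ and relations $R^{\mathbf{B}}$; variables have sorts $s(v)$; a "map $f:V\to B$" sends each $v\in V$ into $B_{s(v)}$; $f\upharpoonright U$ is restriction and $f[y\to b]$ the extension mapping $y$ to $b$ (extended elementwise to sets of maps). A qc-formula is built from atoms, conjunction (arbitrary finite arity), $\forall,\exists$; $\mathrm{free}(\phi)$ denotes free variables; a QCSP instance $(\phi,\mathbf{B})$ is a qc-sentence with a structure of the same signature. $I_\phi$ has one index per subformula occurrence of $\phi$, $\phi(i)$ is the subformula at $i$, parent/child refer to the syntax tree. A judgement is $(i,V,F)$ with $i\in I_\phi$, $V\subseteq\mathrm{free}(\phi(i))$, $F$ a set of maps $V\to B$ (exactly one map $\emptyset\to B$ exists); empty if $F=\emptyset$; width $|V|$. $F_1\Join F_2=\{f:U_1\cup U_2\to B: f\upharpoonright U_1\in F_1,f\upharpoonright U_2\in F_2\}$; for $y\in U$, $\epsilon_yF=\{f:U\setminus\{y\}\to B: f[y\to b]\in F$ for all $b\in B_{s(y)}\}$. A judgement proof is a finite sequence of judgements each of one of the types: (atom) $(i,\{v_1,\dots,v_k\},F)$ with $\phi(i)=R(v_1,\dots,v_k)$ and $F=\{f:(f(v_1),\dots,f(v_k))\in R^{\mathbf{B}}\}$; (projection) $(i,U,F\upharpoonright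 U)$ from previous $(i,V,F)$, $U\subseteq V$; (join) $(i,U_1\cup U_2,F_1\Join F_2)$ from previous $(i,U_1,F_1),(i,U_2,F_2)$; (upward flow) $(i,V,F)$ from previous $(j,V,F)$, $i$ the parent of $j$; ($\forall$-elimination) $(i,V\setminus\{y\},\epsilon_yF)$ from previous $(j,V,F)$ with $y\in V$, $\phi(i)=\forall y\,\phi(j)$, $i$ parent of $j$; (downward flow) $(j,V,F)$ from previous $(i,V,F)$, $i$ parent of $j$. Width of a proof = maximum width of its judgements. $(\phi,\mathbf{B})$ is $k$-judge-consistent if no judgement proof of width at most $k$ contains an empty judgement. A $k$-constraint system $P$ for $(\phi,\mathbf{B})$ assigns to each $i\in I_\phi$ and each $V\subseteq\mathrm{free}(\phi(i))$ with $|V|\le k$ a non-empty set $P[i,V]$ of maps $V\to B$ such that: ($\alpha$) if $\phi(i)$ is an atom $R(v_1,\dots,v_m)$ and $V=\{v_1,\dots,v_m\}$ then $P[i,V]\subseteq\{f:(f(v_1),\dots,f(v_m))\in R^{\mathbf{B}}\}$; ($\pi$) if $U\subseteq V$ then $P[i,U]=P[i,V]\upharpoonright U$; ($\lambda$) if $j$ is a child of $i$ and $V\subseteq\mathrm{free}(\phi(j))$ then $P[i,V]=P[j,V]$; ($\epsilon$) if $j$ is a child of $i$, $\phi(i)=\forall y\,\phi(j)$, $U\subseteq\mathrm{free}(\phi(j))$ with $|U|\le k$ and $y\in U$, and $V=U\setminus\{y\}$, then $P[i,V]\subseteq\epsilon_y(P[j,U])$. -}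

module Defs where

open import Level using (0ℓ)
open import Data.Nat using (ℕ; zero; suc; _+_; _≤_)
open import Data.Fin using (Fin; zero; suc; _≟_)
open import Data.Bool using (Bool; true; false; _∨_; _∧_; not; T; if_then_else_)
open import Data.Unit using (tt)
open import Data.Product using (Σ; Σ-syntax; ∃; _×_; _,_)
open import Data.List using (List; []; _∷_)
open import Data.List.Membership.Propositional using (_∈_)
open import Data.List.Relation.Unary.All using (All)
open import Data.List.Relation.Unary.Any using (Any)
open import Relation.Nullary using (¬_; yes; no)
open import Relation.Nullary.Decidable using (isYes)
open import Relation.Binary.PropositionalEquality using (_≡_; refl; subst; sym)

record Signature : Set₁ where
  field
    Sort  : Set
    Rel   : Set
    arity : Rel → ℕ
    sorts : (R : Rel) → Fin (arity R) → Sort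

record Structure (Sg : Signature) : Set₁ where
  open Signature Sg
  field
    univ : Sort → Set
    rel  : (R : Rel) → ((j : Fin (arity R)) → univ (sorts R j)) → Set

VarSet : ℕ → Set
VarSet n = Fin n → Bool

infix 4 _∈ᵛ_ _⊆ᵛ_
_∈ᵛ_ : ∀ {n} → Fin n → VarSet n → Set
x ∈ᵛ V = T (V x)

_⊆ᵛ_ : ∀ {n} → VarSet n → VarSet n → Set
U ⊆ᵛ V = ∀ x → x ∈ᵛ U → x ∈ᵛ V

∅ᵛ : ∀ {n} → VarSet n
∅ᵛ _ = false

⁅_⁆ᵛ : ∀ {n} → Fin n → VarSet n
⁅ y ⁆ᵛ x = isYes (x ≟ y)

_∪ᵛ_ : ∀ {n} → VarSet n → VarSet n → VarSet n
(U ∪ᵛ V) x = U x ∨ V x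

remove : ∀ {n} → Fin n → VarSet n → VarSet n
remove y V x = V x ∧ not (isYes (x ≟ y))

⋃ᵛ : ∀ {n} (m : ℕ) → (Fin m → VarSet n) → VarSet n
⋃ᵛ zero    F = ∅ᵛ
⋃ᵛ (suc m) F = F zero ∪ᵛ ⋃ᵛ m (λ j → F (suc j))

size : ∀ {n} → VarSet n → ℕ
size {zero}  V = 0
size {suc n} V = (if V zero then 1 else 0) + size (λ x → V (suc x))

∨-inl : ∀ a b → T a → T (a ∨ b)
∨-inl true b _ = tt

∨-inr : ∀ a b → T b → T (a ∨ b)
∨-inr true  b _ = tt
∨-inr false b p = p

∈⁅⁆ : ∀ {n} (y : Fin n) → y ∈ᵛ ⁅ y ⁆ᵛ
∈⁅⁆ y with y ≟ y
... | yes _ = tt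
... | no ne = ne refl

∈⋃ : ∀ {n} m (F : Fin m → VarSet n) (j : Fin m) (x : Fin n) → x ∈ᵛ F j → x ∈ᵛ ⋃ᵛ m F
∈⋃ (suc m) F zero    x p = ∨-inl (F zero x) _ p
∈⋃ (suc m) F (suc j) x p = ∨-inr (F zero x) _ (∈⋃ m (λ j → F (suc j)) j x p)

∈remove : ∀ {n} (y x : Fin n) (V : VarSet n) → ¬ x ≡ y → x ∈ᵛ V → x ∈ᵛ remove y V
∈remove y x V ne p with V x | x ≟ y
... | true | yes e = ne e
... | true | no _  = tt

module Syntax (Sg : Signature) {nv : ℕ} (s : Fin nv → Signature.Sort Sg) where
  open Signature Sg

  Var : Set
  Var = Fin nv

  data Form : Set where
    atom : (R : Rel) (v : Fin (arity R) → Var) → (∀ j → s (v j) ≡ sorts R j) → Form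
    conj : (m : ℕ) → (Fin m → Form) → Form
    all  : Var → Form → Form
    ex   : Var → Form → Form

  free : Form → VarSet nv
  free (atom R v _) = ⋃ᵛ (arity R) (λ j → ⁅ v j ⁆ᵛ)
  free (conj m ψ)   = ⋃ᵛ m (λ j → free (ψ j))
  free (all y ψ)    = remove y (free ψ)
  free (ex y ψ)     = remove y (free ψ)

  IsSentence : Form → Set
  IsSentence φ = ∀ x → ¬ (x ∈ᵛ free φ)

  -- I_φ : subformula occurrences (positions in the syntax tree)
  data Pos : Form → Set where
    here  : ∀ {φ} → Pos φ
    inConj : ∀ {m ψ} (j : Fin m) → Pos (ψ j) → Pos (conj m ψ)
    inAll : ∀ {y ψ} → Pos ψ → Pos (all y ψ)
    inEx  : ∀ {y ψ} → Pos ψ → Pos (ex y ψ)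

  sub : ∀ {φ} → Pos φ → Form
  sub {φ} here     = φ
  sub (inConj j p) = sub p
  sub (inAll p)    = sub p
  sub (inEx p)     = sub p

  data Child : ∀ {φ} → Pos φ → Pos φ → Set where
    conj-c : ∀ {m ψ} (j : Fin m) → Child {conj m ψ} here (inConj j here)
    all-c  : ∀ {y ψ} → Child {all y ψ} here (inAll here)
    ex-c   : ∀ {y ψ} → Child {ex y ψ} here (inEx here)
    conj-d : ∀ {m ψ} (j : Fin m) {p q : Pos (ψ j)} → Child p q → Child (inConj {m} {ψ} j p) (inConj j q)
    all-d  : ∀ {y ψ} {p q : Pos ψ} → Child p q → Child (inAll {y} p) (inAll {y} q)
    ex-d   : ∀ {y ψ} {p q : Pos ψ} → Child p q → Child (inEx {y} p) (inEx {y} q)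

  module Over (B : Structure Sg) where
    open Structure B

    Map : VarSet nv → Set
    Map V = (x : Var) → x ∈ᵛ V → univ (s x)

    MapSet : VarSet nv → Set₁
    MapSet V = Map V → Set

    _⊆ₘ_ : ∀ {V} → MapSet V → MapSet V → Set
    F ⊆ₘ G = ∀ f → F f → G f

    _≐ₘ_ : ∀ {V} → MapSet V → MapSet V → Set
    F ≐ₘ G = (F ⊆ₘ G) × (G ⊆ₘ F)

    NonEmpty : ∀ {V} → MapSet V → Set
    NonEmpty F = ∃ λ f → F f

    restrictMap : ∀ {U V} → U ⊆ᵛ V → Map V → Map U
    restrictMap U⊆V f x p = f x (U⊆V x p)

    restrict : ∀ {U V} → U ⊆ᵛ V → MapSet V → MapSet U
    restrict U⊆V F g = Σ[ f ∈ Map _ ] (F f × (∀ x p → g x p ≡ restrictMap U⊆V f x p))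

    join : ∀ {U₁ U₂} → MapSet U₁ → MapSet U₂ → MapSet (U₁ ∪ᵛ U₂)
    join {U₁} {U₂} F₁ F₂ f =
      F₁ (λ x p → f x (∨-inl (U₁ x) (U₂ x) p)) × F₂ (λ x p → f x (∨-inr (U₁ x) (U₂ x) p))

    extend : ∀ {U} (y : Var) → Map (remove y U) → univ (s y) → Map U
    extend {U} y f b x p with x ≟ y
    ... | yes refl = b
    ... | no ne    = f x (∈remove y x U ne p)

    eps : ∀ {U} (y : Var) → MapSet U → MapSet (remove y U)
    eps y F f = ∀ b → F (extend y f b)

    atomSet : (R : Rel) (v : Fin (arity R) → Var) (ws : ∀ j → s (v j) ≡ sorts R j)
            → MapSet (free (atom R v ws))
    atomSet R v ws f =
      rel R (λ j → subst univ (ws j) (f (v j) (∈⋃ (arity R) (λ j → ⁅ v j ⁆ᵛ) j (v j) (∈⁅⁆ (v j)))))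

    -- (i, V, F); the side condition V ⊆ free(φ(i)) is WellFormed below
    Judgement : Form → Set₁
    Judgement φ = Σ[ i ∈ Pos φ ] Σ[ V ∈ VarSet nv ] MapSet V

    WellFormed : ∀ {φ} → Judgement φ → Set
    WellFormed (i , V , F) = V ⊆ᵛ free (sub i)

    IsEmpty : ∀ {φ} → Judgement φ → Set
    IsEmpty (i , V , F) = ∀ f → ¬ F f

    width : ∀ {φ} → Judgement φ → ℕ
    width (i , V , F) = size V

    data Step {φ : Form} : Judgement φ → List (Judgement φ) → Set₁ where
      atomR : ∀ {js} (i : Pos φ) R v ws → sub i ≡ atom R v ws
            → Step (i , free (atom R v ws) , atomSet R v ws) js
      projR : ∀ {js i U V F} (U⊆V : U ⊆ᵛ V) → (i , V , F) ∈ js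
            → Step (i , U , restrict U⊆V F) js
      joinR : ∀ {js i U₁ U₂ F₁ F₂} → (i , U₁ , F₁) ∈ js → (i , U₂ , F₂) ∈ js
            → Step (i , U₁ ∪ᵛ U₂ , join F₁ F₂) js
      upR   : ∀ {js i j V F} → Child i j → (j , V , F) ∈ js
            → Step (i , V , F) js
      elimR : ∀ {js i j V F} (y : Var) → Child i j → sub i ≡ all y (sub j) → y ∈ᵛ V
            → (j , V , F) ∈ js
            → Step (i , remove y V , eps y F) js
      downR : ∀ {js i j V F} → Child i j → (i , V , F) ∈ js
            → Step (j , V , F) js

    -- a judgement proof, stored newest-first: J ∷ js means J comes after all of js
    data Proof {φ : Form} : List (Judgement φ) → Set₁ where
      []   : Proof []
      _∷_  : ∀ {J js} → Step J js × WellFormed J → Proof js → Proof (J ∷ js)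

    JudgeConsistent : Form → ℕ → Set₁
    JudgeConsistent φ k =
      ∀ (js : List (Judgement φ)) → Proof js → All (λ J → width J ≤ k) js
      → ¬ Any IsEmpty js

    -- k-constraint systems.  P is given on all (i, V); the conditions are
    -- imposed only where P[i,V] is defined: V ⊆ free(φ(i)), |V| ≤ k.

    record ConstraintSystem (φ : Form) (k : ℕ) : Set₁ where
      field
        P : Pos φ → (V : VarSet nv) → MapSet V
        nonEmpty : ∀ i V → V ⊆ᵛ free (sub i) → size V ≤ k → NonEmpty (P i V)
        cond-α : ∀ i R v ws → sub i ≡ atom R v ws → size (free (atom R v ws)) ≤ k
               → P i (free (atom R v ws)) ⊆ₘ atomSet R v ws
        cond-π : ∀ i U V (U⊆V : U ⊆ᵛ V) → V ⊆ᵛ free (sub i) → size V ≤ k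
               → P i U ≐ₘ restrict U⊆V (P i V)
        cond-λ : ∀ i j V → Child i j → V ⊆ᵛ free (sub j) → V ⊆ᵛ free (sub i) → size V ≤ k
               → P i V ≐ₘ P j V
        cond-ε : ∀ i j y U → Child i j → sub i ≡ all y (sub j)
               → U ⊆ᵛ free (sub j) → size U ≤ k → y ∈ᵛ U
               → P i (remove y U) ⊆ₘ eps y (P j U)

module Submission where

open import Defs
open import Data.Nat using (ℕ; _≤_)
open import Data.Fin using (Fin)
open import Data.Product using (_×_; _,_; proj₁; proj₂)
open import Data.List using (List; []; _∷_)
open import Data.List.Relation.Unary.All as All using (All; []; _∷_; lookup)
open import Data.List.Relation.Unary.All.Properties using (All¬⇒¬Any)
open import Relation.Binary.PropositionalEquality using (refl)
open import Relation.Nullary using (¬_)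

-- A k-constraint system P is an invariant of width-k judgement proofs: every
-- derived judgement (i, V, F) satisfies P[i,V] ⊆ F, each rule being matched by
-- the constraint-system condition of the same name (α for atoms, π for
-- projection and join, λ for the flows, ε for ∀-elimination).  Since P[i,V] is
-- non-empty, no derived judgement is empty.

module ConstraintSystemSoundness
  (Sg : Signature) (nv : ℕ) (s : Fin nv → Signature.Sort Sg) (B : Structure Sg)
  {φ : Syntax.Form Sg s} {k : ℕ} (CS : Syntax.Over.ConstraintSystem Sg s B φ k)
  where

  open Syntax Sg s
  open Over B
  open ConstraintSystem CS

  Narrow : Judgement φ → Set
  Narrow J = width J ≤ k

  Covered : Judgement φ → Set
  Covered (i , V , F) = P i V ⊆ₘ F

  Supported : Judgement φ → Set
  Supported J = WellFormed J × Narrow J × Covered J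

  P-⊆-join : ∀ i U₁ U₂ → U₁ ∪ᵛ U₂ ⊆ᵛ free (sub i) → size (U₁ ∪ᵛ U₂) ≤ k
           → P i (U₁ ∪ᵛ U₂) ⊆ₘ join (P i U₁) (P i U₂)
  P-⊆-join i U₁ U₂ wf w f pf =
    restrictedTo U₁ (λ x → ∨-inl (U₁ x) (U₂ x)) , restrictedTo U₂ (λ x → ∨-inr (U₁ x) (U₂ x))
    where
    restrictedTo : ∀ U (U⊆ : U ⊆ᵛ U₁ ∪ᵛ U₂) → P i U (restrictMap U⊆ f)
    restrictedTo U U⊆ = proj₂ (cond-π i U (U₁ ∪ᵛ U₂) U⊆ wf w) _ (f , pf , λ _ _ → refl)

  step-covered : ∀ {J js} → Step J js → WellFormed J → Narrow J → All Supported js → Covered J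
  step-covered (atomR i R v ws i≡atom) wf w prev = cond-α i R v ws i≡atom w
  step-covered (projR {i = i} {U} {V} U⊆V J∈) wf w prev g pg
    with wfV , wV , covV ← lookup prev J∈
    with f , pf , g≡f↾U ← proj₁ (cond-π i U V U⊆V wfV wV) g pg
    = f , covV f pf , g≡f↾U
  step-covered (joinR {i = i} {U₁} {U₂} J₁∈ J₂∈) wf w prev f pf
    with _ , _ , cov₁ ← lookup prev J₁∈
    with _ , _ , cov₂ ← lookup prev J₂∈
    with f₁ , f₂ ← P-⊆-join i U₁ U₂ wf w f pf
    = cov₁ _ f₁ , cov₂ _ f₂
  step-covered (upR {i = i} {j} {V} i→j J∈) wf w prev f pf
    with wfj , _ , covj ← lookup prev J∈
    = covj f (proj₁ (cond-λ i j V i→j wfj wf w) f pf)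
  step-covered (elimR {i = i} {j} {V} y i→j i≡∀ y∈V J∈) wf w prev f pf b
    with wfj , wj , covj ← lookup prev J∈
    = covj _ (cond-ε i j y V i→j i≡∀ wfj wj y∈V f pf b)
  step-covered (downR {i = i} {j} {V} i→j J∈) wf w prev f pf
    with wfi , _ , covi ← lookup prev J∈
    = covi f (proj₂ (cond-λ i j V i→j wf wfi w) f pf)

  proof-supported : ∀ {js} → Proof js → All Narrow js → All Supported js
  proof-supported [] [] = []
  proof-supported ((step , wf) ∷ pr) (w ∷ ws) =
    (wf , w , step-covered step wf w prev) ∷ prev
    where prev = proof-supported pr ws

  supported-nonEmpty : ∀ {J} → Supported J → ¬ IsEmpty J
  supported-nonEmpty {i , V , F} (wf , w , cov) empty
    with f , pf ← nonEmpty i V wf w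
    = empty f (cov f pf)

  judgeConsistent : JudgeConsistent φ k
  judgeConsistent js pr ws = All¬⇒¬Any (All.map supported-nonEmpty (proof-supported pr ws))

lemmaC1 : (Sg : Signature) (nv : ℕ) (s : Fin nv → Signature.Sort Sg) (B : Structure Sg)
          (φ : Syntax.Form Sg s) → Syntax.IsSentence Sg s φ
          → (k : ℕ) → 1 ≤ k
          → Syntax.Over.ConstraintSystem Sg s B φ k
          → Syntax.Over.JudgeConsistent Sg s B φ k
lemmaC1 Sg nv s B φ _ k _ CS = ConstraintSystemSoundness.judgeConsistent Sg nv s B CS
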